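{- For every integer $n\ge 0$, $$d_n=\sum_{k=0}^{n}(-1)^{n-k}\binom{n}{k}m_k,$$ where $d_n$ denotes the number of symmetric Dyck paths of length $2n$ and $m_n$ denotes the number of symmetric Motzkin paths of length $2n$.
   Context: Steps: up step $U=(1,1)$, down step $D=(1,-1)$, horizontal step $h=(1,0)$. A Dyck path of length $2n$ is a lattice path from $(0,0)$ to $(2n,0)$ using steps $U,D$ that never goes below the $x$-axis; a Motzkin path of length $2n$ is the same but steps $U,D,h$ are allowed. A path of length $2n$ is symmetric if it passes through a lattice point with $x$-coordinate $n$ and its part on $[n,2n]$ is the mirror image of its part on $[0,n]$ under the reflection $x\mapsto 2n-x$. Thus $d_n=\binom{n}{\lfloor n/2\rfloor}$ and $m_n$ ($1,2,5,13,35,\dots$) count the symmetric Dyck and symmetric Motzkin paths of length $2n$ respectively. -}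

module Defs where

open import Data.Nat using (ℕ; zero; suc; _+_; _*_; _∸_)
open import Data.Integer as ℤ using (ℤ; +_)
open import Data.List using (List; []; _∷_; map; concatMap; reverse; length; filter; upTo; sum; foldr)
open import Data.Bool using (Bool; true; false; _∧_)
open import Data.Nat.Combinatorics using (_C_)
open import Relation.Nullary using (Dec; yes; no)
open import Relation.Binary.PropositionalEquality using (_≡_)

-- Lattice path steps: U = (1,1), D = (1,-1), h = (1,0).
data Step : Set where
  U D h : Step

Path : Set
Path = List Step

words : List Step → ℕ → List Path
words A zero = [] ∷ []
words A (suc k) = concatMap (λ s → map (s ∷_) (words A k)) A

validFrom : ℕ → Path → Bool
validFrom zero [] = true
validFrom (suc _) [] = false
validFrom ht (U ∷ p) = validFrom (suc ht) p
validFrom zero (D ∷ p) = false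
validFrom (suc ht) (D ∷ p) = validFrom ht p
validFrom ht (h ∷ p) = validFrom ht p

-- Mirror image under x ↦ 2n - x: reverse the step order and swap U/D.
flipStep : Step → Step
flipStep U = D
flipStep D = U
flipStep h = h

mirror : Path → Path
mirror p = reverse (map flipStep p)

_≟S_ : (a b : Step) → Bool
U ≟S U = true
D ≟S D = true
h ≟S h = true
_ ≟S _ = false

eqPath : Path → Path → Bool
eqPath [] [] = true
eqPath (a ∷ p) (b ∷ q) = (a ≟S b) ∧ eqPath p q
eqPath _ _ = false

-- A path (of even length 2n) is symmetric iff it equals its mirror image
-- (the midpoint has x-coordinate n automatically since every step has x-length 1).
isSymmetric : Path → Bool
isSymmetric p = eqPath p (mirror p)

count : (Path → Bool) → List Path → ℕ
count P [] = 0
count P (x ∷ xs) with P x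
... | true = suc (count P xs)
... | false = count P xs

d : ℕ → ℕ
d n = count (λ p → validFrom 0 p ∧ isSymmetric p) (words (U ∷ D ∷ []) (n + n))

m : ℕ → ℕ
m n = count (λ p → validFrom 0 p ∧ isSymmetric p) (words (U ∷ D ∷ h ∷ []) (n + n))

sgn : ℕ → ℤ
sgn zero = + 1
sgn (suc j) = ℤ.- sgn j

altSum : ℕ → ℤ
altSum n = foldr ℤ._+_ (+ 0) (map (λ k → sgn (n ∸ k) ℤ.* (+ (n C k)) ℤ.* (+ m k)) (upTo (suc n)))

module Submission where

-- A symmetric path of length 2n is q ++ mirror q for its first half q, and
-- q ++ mirror q stays weakly above the axis iff q does.  So the symmetric paths over an
-- alphabet are counted by the meanders of length n: words that never go below the axis,
-- with free end height.  Hence d n and m n are the numbers of Dyck and Motzkin meanders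
-- of length n starting at height 0.
-- First steps.  Writing M₂(t,n), M₃(t,n) for meanders from height t, removing the first
-- step gives M₂(t,n+1) = M₂(t+1,n) + M₂(t-1,n) and M₃(t,k+1) - M₃(t,k) = M₃(t+1,k) + M₃(t-1,k),
-- the terms at height t-1 being absent when t = 0.
-- Finite differences.  finiteDiff n b = Σ_k (-1)^(n-k) C(n,k) b k is the n-th forward
-- difference of b at 0: it is linear and finiteDiff (n+1) b = finiteDiff n (Δ b).
-- Induction on n, for all start heights at once, gives M₂(t,n) = finiteDiff n (M₃(t,·));
-- the theorem is the case t = 0.

open import Defs
open import Data.Nat as ℕ using (ℕ; zero; suc; _∸_; _<_; _<?_; s≤s)
import Data.Nat.Properties as ℕP
open import Data.Nat.Combinatorics using (_C_; nCk+nC[k+1]≡[n+1]C[k+1]; k>n⇒nCk≡0)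
open import Data.Integer using (ℤ; +_; -_; _+_; _-_; _*_)
import Data.Integer.Properties as ℤP
open import Data.Integer.Tactic.RingSolver using (solve-∀)
open import Data.List using (List; []; _∷_; _++_; map; concatMap; reverse; length; foldr; applyUpTo)
import Data.List.Properties as LP
open import Data.List.Relation.Unary.All as All using (All; []; _∷_)
open import Data.List.Relation.Unary.All.Properties using (++⁺; map⁺)
open import Data.Bool using (Bool; true; false; _∧_)
open import Data.Bool.Properties using (∧-identityʳ; ∧-zeroʳ)
open import Data.Maybe using (Maybe; just; nothing; is-just; maybe′)
open import Function using (_∘_; id)
open import Relation.Nullary using (yes; no)
open import Relation.Binary.PropositionalEquality
open ≡-Reasoning

sumOver : {A : Set} → List A → (A → ℕ) → ℕ
sumOver []       f = 0
sumOver (x ∷ xs) f = f x ℕ.+ sumOver xs f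

ind : Bool → ℕ
ind true  = 1
ind false = 0

count≡sumOver : ∀ (P : Path → Bool) xs → count P xs ≡ sumOver xs (ind ∘ P)
count≡sumOver P []       = refl
count≡sumOver P (x ∷ xs) with P x
... | true  = cong suc (count≡sumOver P xs)
... | false = count≡sumOver P xs

sumOver-++ : {A : Set} (xs ys : List A) (f : A → ℕ) →
             sumOver (xs ++ ys) f ≡ sumOver xs f ℕ.+ sumOver ys f
sumOver-++ []       ys f = refl
sumOver-++ (x ∷ xs) ys f =
  trans (cong (f x ℕ.+_) (sumOver-++ xs ys f)) (sym (ℕP.+-assoc (f x) _ _))

sumOver-map : {A B : Set} (g : A → B) (xs : List A) (f : B → ℕ) →
              sumOver (map g xs) f ≡ sumOver xs (f ∘ g)
sumOver-map g []       f = refl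
sumOver-map g (x ∷ xs) f = cong (f (g x) ℕ.+_) (sumOver-map g xs f)

sumOver-cong : {A : Set} (xs : List A) {f g : A → ℕ} →
               (∀ x → f x ≡ g x) → sumOver xs f ≡ sumOver xs g
sumOver-cong []       eq = refl
sumOver-cong (x ∷ xs) eq = cong₂ ℕ._+_ (eq x) (sumOver-cong xs eq)

sumOver-congᴬ : {A : Set} {P : A → Set} {xs : List A} {f g : A → ℕ} →
                All P xs → (∀ x → P x → f x ≡ g x) → sumOver xs f ≡ sumOver xs g
sumOver-congᴬ                [] eq = refl
sumOver-congᴬ {xs = x ∷ xs} (px ∷ pxs) eq = cong₂ ℕ._+_ (eq x px) (sumOver-congᴬ pxs eq)

sumOver-zero : {A : Set} (xs : List A) → sumOver xs (λ _ → 0) ≡ 0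
sumOver-zero []       = refl
sumOver-zero (x ∷ xs) = sumOver-zero xs

sumOver-*ʳ : {A : Set} (xs : List A) (f : A → ℕ) (c : ℕ) →
             sumOver xs (λ x → f x ℕ.* c) ≡ sumOver xs f ℕ.* c
sumOver-*ʳ []       f c = refl
sumOver-*ʳ (x ∷ xs) f c =
  trans (cong (f x ℕ.* c ℕ.+_) (sumOver-*ʳ xs f c)) (sym (ℕP.*-distribʳ-+ c (f x) _))

sumOver-concatMap : {A B : Set} (g : A → List B) (xs : List A) (f : B → ℕ) →
                    sumOver (concatMap g xs) f ≡ sumOver xs (λ x → sumOver (g x) f)
sumOver-concatMap g []       f = refl
sumOver-concatMap g (x ∷ xs) f =
  trans (sumOver-++ (g x) (concatMap g xs) f) (cong (sumOver (g x) f ℕ.+_) (sumOver-concatMap g xs f))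

sumOver-words-suc : ∀ A k (f : Path → ℕ) →
  sumOver (words A (suc k)) f ≡ sumOver A (λ s → sumOver (words A k) (λ q → f (s ∷ q)))
sumOver-words-suc A k f =
  trans (sumOver-concatMap (λ s → map (s ∷_) (words A k)) A f)
        (sumOver-cong A (λ s → sumOver-map (s ∷_) (words A k) f))

sumOver-words-+ : ∀ A a b (f : Path → ℕ) →
  sumOver (words A (a ℕ.+ b)) f ≡ sumOver (words A a) (λ q → sumOver (words A b) (λ r → f (q ++ r)))
sumOver-words-+ A zero    b f = sym (ℕP.+-identityʳ _)
sumOver-words-+ A (suc a) b f = begin
  sumOver (words A (suc (a ℕ.+ b))) f
    ≡⟨ sumOver-words-suc A (a ℕ.+ b) f ⟩
  sumOver A (λ s → sumOver (words A (a ℕ.+ b)) (λ q → f (s ∷ q)))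
    ≡⟨ sumOver-cong A (λ s → sumOver-words-+ A a b (λ q → f (s ∷ q))) ⟩
  sumOver A (λ s → sumOver (words A a) (λ q → sumOver (words A b) (λ r → f (s ∷ q ++ r))))
    ≡⟨ sumOver-words-suc A a _ ⟨
  sumOver (words A (suc a)) (λ q → sumOver (words A b) (λ r → f (q ++ r))) ∎

sumOver-words-cong : ∀ {P : Step → Set} A → All P A → ∀ n {f g : Path → ℕ} →
  (∀ q → All P q → length q ≡ n → f q ≡ g q) → sumOver (words A n) f ≡ sumOver (words A n) g
sumOver-words-cong A letters zero    eq = cong (ℕ._+ 0) (eq [] [] refl)
sumOver-words-cong A letters (suc n) {f} {g} eq = begin
  sumOver (words A (suc n)) f
    ≡⟨ sumOver-words-suc A n f ⟩
  sumOver A (λ s → sumOver (words A n) (λ q → f (s ∷ q)))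
    ≡⟨ sumOver-congᴬ letters (λ s ps → sumOver-words-cong A letters n
         (λ q pq len → eq (s ∷ q) (ps ∷ pq) (cong suc len))) ⟩
  sumOver A (λ s → sumOver (words A n) (λ q → g (s ∷ q)))
    ≡⟨ sumOver-words-suc A n g ⟨
  sumOver (words A (suc n)) g ∎

≟S-sound : ∀ a b → (a ≟S b) ≡ true → a ≡ b
≟S-sound U U _ = refl
≟S-sound D D _ = refl
≟S-sound h h _ = refl
≟S-sound U D ()
≟S-sound U h ()
≟S-sound D U ()
≟S-sound D h ()
≟S-sound h U ()
≟S-sound h D ()

≟S-refl : ∀ a → (a ≟S a) ≡ true
≟S-refl U = refl
≟S-refl D = refl
≟S-refl h = refl

eqPath-sound : ∀ x y → eqPath x y ≡ true → x ≡ y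
eqPath-sound []      []      _ = refl
eqPath-sound (a ∷ x) (b ∷ y) e with a ≟S b in a≡b
... | true = cong₂ _∷_ (≟S-sound a b a≡b) (eqPath-sound x y e)
eqPath-sound []      (_ ∷ _) ()
eqPath-sound (_ ∷ _) []      ()

eqPath-refl : ∀ x → eqPath x x ≡ true
eqPath-refl []      = refl
eqPath-refl (a ∷ x) rewrite ≟S-refl a = eqPath-refl x

OccursOnce : List Step → Step → Set
OccursOnce A c = sumOver A (λ s → ind (s ≟S c)) ≡ 1

words-unique : ∀ A t → All (OccursOnce A) t →
               sumOver (words A (length t)) (λ r → ind (eqPath r t)) ≡ 1
words-unique A []      []             = refl
words-unique A (c ∷ t) (once ∷ onces) = begin
  sumOver (words A (suc (length t))) (λ r → ind (eqPath r (c ∷ t)))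
    ≡⟨ sumOver-words-suc A (length t) _ ⟩
  sumOver A (λ s → sumOver (words A (length t)) (λ q → ind ((s ≟S c) ∧ eqPath q t)))
    ≡⟨ sumOver-cong A firstLetter ⟩
  sumOver A (λ s → ind (s ≟S c))
    ≡⟨ once ⟩
  1 ∎
  where
  firstLetter : ∀ s → sumOver (words A (length t)) (λ q → ind ((s ≟S c) ∧ eqPath q t)) ≡ ind (s ≟S c)
  firstLetter s with s ≟S c
  ... | true  = words-unique A t onces
  ... | false = sumOver-zero (words A (length t))

words-select : ∀ A n t (P : Path → Bool) → All (OccursOnce A) t → length t ≡ n →
               sumOver (words A n) (λ r → ind (P r ∧ eqPath r t)) ≡ ind (P t)
words-select A .(length t) t P onces refl = begin
  sumOver W (λ r → ind (P r ∧ eqPath r t))             ≡⟨ sumOver-cong W atT ⟩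
  sumOver W (λ r → ind (eqPath r t) ℕ.* ind (P t))     ≡⟨ sumOver-*ʳ W _ (ind (P t)) ⟩
  sumOver W (λ r → ind (eqPath r t)) ℕ.* ind (P t)     ≡⟨ cong (ℕ._* ind (P t)) (words-unique A t onces) ⟩
  1 ℕ.* ind (P t)                                      ≡⟨ ℕP.*-identityˡ _ ⟩
  ind (P t) ∎
  where
  W : List Path
  W = words A (length t)
  atT : ∀ r → ind (P r ∧ eqPath r t) ≡ ind (eqPath r t) ℕ.* ind (P t)
  atT r with eqPath r t in r≡t
  ... | false = cong ind (∧-zeroʳ (P r))
  ... | true rewrite eqPath-sound r t r≡t = trans (cong ind (∧-identityʳ (P t))) (sym (ℕP.+-identityʳ _))

flipStep-involutive : ∀ c → flipStep (flipStep c) ≡ c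
flipStep-involutive U = refl
flipStep-involutive D = refl
flipStep-involutive h = refl

mirror-involutive : ∀ q → mirror (mirror q) ≡ q
mirror-involutive q = begin
  reverse (map flipStep (reverse (map flipStep q)))
    ≡⟨ cong reverse (LP.reverse-map flipStep (map flipStep q)) ⟩
  reverse (reverse (map flipStep (map flipStep q)))   ≡⟨ LP.reverse-involutive _ ⟩
  map flipStep (map flipStep q)                       ≡⟨ LP.map-∘ q ⟨
  map (flipStep ∘ flipStep) q                         ≡⟨ LP.map-cong flipStep-involutive q ⟩
  map id q                                            ≡⟨ LP.map-id q ⟩
  q ∎

mirror-++ : ∀ q r → mirror (q ++ r) ≡ mirror r ++ mirror q
mirror-++ q r = trans (cong reverse (LP.map-++ flipStep q r)) (LP.reverse-++ (map flipStep q) (map flipStep r))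

mirror-∷ : ∀ c q r → mirror (c ∷ q) ++ r ≡ mirror q ++ (flipStep c ∷ r)
mirror-∷ c q r = begin
  reverse (flipStep c ∷ map flipStep q) ++ r
    ≡⟨ cong (_++ r) (LP.unfold-reverse (flipStep c) (map flipStep q)) ⟩
  (mirror q ++ (flipStep c ∷ [])) ++ r
    ≡⟨ LP.++-assoc (mirror q) _ r ⟩
  mirror q ++ (flipStep c ∷ r) ∎

length-mirror : ∀ q → length (mirror q) ≡ length q
length-mirror q = trans (LP.length-reverse (map flipStep q)) (LP.length-map flipStep q)

All-reverse : {A : Set} {P : A → Set} {xs : List A} → All P xs → All P (reverse xs)
All-reverse                 []         = []
All-reverse {xs = x ∷ xs} (px ∷ pxs) =
  subst (All _) (sym (LP.unfold-reverse x xs)) (++⁺ (All-reverse pxs) (px ∷ []))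

All-mirror : {P : Step → Set} → (∀ c → P c → P (flipStep c)) → ∀ {q} → All P q → All P (mirror q)
All-mirror flipP pq = All-reverse (map⁺ (All.map (flipP _) pq))

++-cancelˡ-length : ∀ (a b c e : Path) → length a ≡ length c → a ++ b ≡ c ++ e → b ≡ e
++-cancelˡ-length []      b []      e _   eq = eq
++-cancelˡ-length (x ∷ a) b (y ∷ c) e len eq =
  ++-cancelˡ-length a b c e (ℕP.suc-injective len) (LP.∷-injectiveʳ eq)

bool-ext : ∀ a b → (a ≡ true → b ≡ true) → (b ≡ true → a ≡ true) → a ≡ b
bool-ext true  true  _ _ = refl
bool-ext false false _ _ = refl
bool-ext true  false f _ = sym (f refl)
bool-ext false true  _ g = g refl

symmetric-split : ∀ q r → length r ≡ length q → isSymmetric (q ++ r) ≡ eqPath r (mirror q)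
symmetric-split q r len = bool-ext _ _ toMirror fromMirror
  where
  toMirror : isSymmetric (q ++ r) ≡ true → eqPath r (mirror q) ≡ true
  toMirror sym-qr = subst (λ x → eqPath r x ≡ true) r≡mirror-q (eqPath-refl r)
    where
    r≡mirror-q : r ≡ mirror q
    r≡mirror-q = ++-cancelˡ-length q r (mirror r) (mirror q)
                   (trans (sym len) (sym (length-mirror r)))
                   (trans (eqPath-sound _ _ sym-qr) (mirror-++ q r))
  fromMirror : eqPath r (mirror q) ≡ true → isSymmetric (q ++ r) ≡ true
  fromMirror r≡ =
    subst (λ w → isSymmetric (q ++ w) ≡ true) (sym (eqPath-sound _ _ r≡))
      (subst (λ x → eqPath (q ++ mirror q) x ≡ true) q++mirror-q-symmetric (eqPath-refl (q ++ mirror q)))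
    where
    q++mirror-q-symmetric : q ++ mirror q ≡ mirror (q ++ mirror q)
    q++mirror-q-symmetric = sym (trans (mirror-++ q (mirror q)) (cong (_++ mirror q) (mirror-involutive q)))

run : ℕ → Path → Maybe ℕ
run ht []       = just ht
run ht (U ∷ p)  = run (suc ht) p
run ht (h ∷ p)  = run ht p
run zero    (D ∷ p) = nothing
run (suc ht) (D ∷ p) = run ht p

validFrom-U : ∀ ht p → validFrom ht (U ∷ p) ≡ validFrom (suc ht) p
validFrom-U zero    p = refl
validFrom-U (suc _) p = refl

validFrom-h : ∀ ht p → validFrom ht (h ∷ p) ≡ validFrom ht p
validFrom-h zero    p = refl
validFrom-h (suc _) p = refl

validFrom-++ : ∀ ht q r → validFrom ht (q ++ r) ≡ maybe′ (λ k → validFrom k r) false (run ht q)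
validFrom-++ ht       []      r = refl
validFrom-++ ht       (U ∷ q) r = trans (validFrom-U ht (q ++ r)) (validFrom-++ (suc ht) q r)
validFrom-++ ht       (h ∷ q) r = trans (validFrom-h ht (q ++ r)) (validFrom-++ ht q r)
validFrom-++ zero     (D ∷ q) r = refl
validFrom-++ (suc ht) (D ∷ q) r = validFrom-++ ht q r

validFrom-mirror : ∀ ht q r k → run ht q ≡ just k → validFrom k (mirror q ++ r) ≡ validFrom ht r
validFrom-mirror ht [] r k refl = refl
validFrom-mirror ht (U ∷ q) r k e =
  trans (cong (validFrom k) (mirror-∷ U q r)) (validFrom-mirror (suc ht) q (D ∷ r) k e)
validFrom-mirror ht (h ∷ q) r k e =
  trans (cong (validFrom k) (mirror-∷ h q r))
        (trans (validFrom-mirror ht q (h ∷ r) k e) (validFrom-h ht r))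
validFrom-mirror zero (D ∷ q) r k ()
validFrom-mirror (suc ht) (D ∷ q) r k e =
  trans (cong (validFrom k) (mirror-∷ D q r))
        (trans (validFrom-mirror ht q (U ∷ r) k e) (validFrom-U ht r))

validFrom-fold : ∀ q → validFrom 0 (q ++ mirror q) ≡ is-just (run 0 q)
validFrom-fold q = trans (validFrom-++ 0 q (mirror q)) (returns (run 0 q) refl)
  where
  returns : ∀ w → run 0 q ≡ w → maybe′ (λ k → validFrom k (mirror q)) false w ≡ is-just w
  returns nothing  _ = refl
  returns (just k) e =
    trans (cong (validFrom k) (sym (LP.++-identityʳ (mirror q)))) (validFrom-mirror 0 q [] k e)

meanders : List Step → ℕ → ℕ → ℕ
meanders A ht n = sumOver (words A n) (λ q → ind (is-just (run ht q)))

symmetric≡meanders : ∀ A → All (OccursOnce A) A →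
  (∀ c → OccursOnce A c → OccursOnce A (flipStep c)) → ∀ n →
  count (λ p → validFrom 0 p ∧ isSymmetric p) (words A (n ℕ.+ n)) ≡ meanders A 0 n
symmetric≡meanders A letters flipClosed n = begin
  count symmetricPath (words A (n ℕ.+ n))
    ≡⟨ count≡sumOver symmetricPath (words A (n ℕ.+ n)) ⟩
  sumOver (words A (n ℕ.+ n)) (ind ∘ symmetricPath)
    ≡⟨ sumOver-words-+ A n n _ ⟩
  sumOver (words A n) (λ q → sumOver (words A n) (λ r → ind (symmetricPath (q ++ r))))
    ≡⟨ sumOver-words-cong A letters n secondHalves ⟩
  sumOver (words A n) (λ q → ind (validFrom 0 (q ++ mirror q)))
    ≡⟨ sumOver-cong (words A n) (cong ind ∘ validFrom-fold) ⟩
  meanders A 0 n ∎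
  where
  symmetricPath : Path → Bool
  symmetricPath p = validFrom 0 p ∧ isSymmetric p
  -- For a first half q, the only second half giving a symmetric path is mirror q.
  secondHalves : ∀ q → All (OccursOnce A) q → length q ≡ n →
    sumOver (words A n) (λ r → ind (symmetricPath (q ++ r))) ≡ ind (validFrom 0 (q ++ mirror q))
  secondHalves q onces len-q = begin
    sumOver (words A n) (λ r → ind (symmetricPath (q ++ r)))
      ≡⟨ sumOver-words-cong A letters n (λ r _ len-r →
           cong (λ b → ind (validFrom 0 (q ++ r) ∧ b)) (symmetric-split q r (trans len-r (sym len-q)))) ⟩
    sumOver (words A n) (λ r → ind (validFrom 0 (q ++ r) ∧ eqPath r (mirror q)))
      ≡⟨ words-select A n (mirror q) (λ r → validFrom 0 (q ++ r))
           (All-mirror flipClosed onces) (trans (length-mirror q) len-q) ⟩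
    ind (validFrom 0 (q ++ mirror q)) ∎

dyckSteps motzkinSteps : List Step
dyckSteps    = U ∷ D ∷ []
motzkinSteps = U ∷ D ∷ h ∷ []

dyck-symmetric : ∀ n → d n ≡ meanders dyckSteps 0 n
dyck-symmetric = symmetric≡meanders dyckSteps (refl ∷ refl ∷ []) flipClosed
  where
  flipClosed : ∀ c → OccursOnce dyckSteps c → OccursOnce dyckSteps (flipStep c)
  flipClosed U _ = refl
  flipClosed D _ = refl
  flipClosed h ()

motzkin-symmetric : ∀ n → m n ≡ meanders motzkinSteps 0 n
motzkin-symmetric = symmetric≡meanders motzkinSteps (refl ∷ refl ∷ refl ∷ []) flipClosed
  where
  flipClosed : ∀ c → OccursOnce motzkinSteps c → OccursOnce motzkinSteps (flipStep c)
  flipClosed U _ = refl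
  flipClosed D _ = refl
  flipClosed h _ = refl

-- Meanders from height ht whose first step is a down step (there are none at height 0).
afterDown : List Step → ℕ → ℕ → ℕ
afterDown A zero     n = 0
afterDown A (suc ht) n = meanders A ht n

afterDown-spec : ∀ A ht n → sumOver (words A n) (λ q → ind (is-just (run ht (D ∷ q)))) ≡ afterDown A ht n
afterDown-spec A zero     n = sumOver-zero (words A n)
afterDown-spec A (suc ht) n = refl

dyck-step : ∀ ht n → meanders dyckSteps ht (suc n) ≡ meanders dyckSteps (suc ht) n ℕ.+ afterDown dyckSteps ht n
dyck-step ht n =
  trans (sumOver-words-suc dyckSteps n _)
        (cong (meanders dyckSteps (suc ht) n ℕ.+_)
              (trans (ℕP.+-identityʳ _) (afterDown-spec dyckSteps ht n)))

motzkin-step : ∀ ht n → meanders motzkinSteps ht (suc n)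
  ≡ meanders motzkinSteps (suc ht) n ℕ.+ afterDown motzkinSteps ht n ℕ.+ meanders motzkinSteps ht n
motzkin-step ht n =
  trans (sumOver-words-suc motzkinSteps n _)
        (trans (cong (meanders motzkinSteps (suc ht) n ℕ.+_)
                     (cong₂ ℕ._+_ (afterDown-spec motzkinSteps ht n) (ℕP.+-identityʳ _)))
               (sym (ℕP.+-assoc (meanders motzkinSteps (suc ht) n) _ _)))

sumBelow : ℕ → (ℕ → ℤ) → ℤ
sumBelow zero    f = + 0
sumBelow (suc n) f = f 0 + sumBelow n (f ∘ suc)

foldr-applyUpTo : ∀ n (f : ℕ → ℕ) (g : ℕ → ℤ) →
                  foldr _+_ (+ 0) (map g (applyUpTo f n)) ≡ sumBelow n (g ∘ f)
foldr-applyUpTo zero    f g = refl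
foldr-applyUpTo (suc n) f g = cong (λ s → g (f 0) + s) (foldr-applyUpTo n (f ∘ suc) g)

sumBelow-cong : ∀ n {f g : ℕ → ℤ} → (∀ k → f k ≡ g k) → sumBelow n f ≡ sumBelow n g
sumBelow-cong zero    eq = refl
sumBelow-cong (suc n) eq = cong₂ _+_ (eq 0) (sumBelow-cong n (eq ∘ suc))

sumBelow-zero : ∀ n → sumBelow n (λ _ → + 0) ≡ + 0
sumBelow-zero zero    = refl
sumBelow-zero (suc n) = trans (ℤP.+-identityˡ _) (sumBelow-zero n)

sumBelow-+ : ∀ n (f g : ℕ → ℤ) → sumBelow n (λ k → f k + g k) ≡ sumBelow n f + sumBelow n g
sumBelow-+ zero    f g = refl
sumBelow-+ (suc n) f g =
  trans (cong (λ s → f 0 + g 0 + s) (sumBelow-+ n (f ∘ suc) (g ∘ suc)))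
        (interchange (f 0) (g 0) (sumBelow n (f ∘ suc)) (sumBelow n (g ∘ suc)))
  where
  interchange : ∀ a b x y → a + b + (x + y) ≡ a + x + (b + y)
  interchange = solve-∀

sumBelow-- : ∀ n (f g : ℕ → ℤ) → sumBelow n (λ k → f k - g k) ≡ sumBelow n f - sumBelow n g
sumBelow-- zero    f g = refl
sumBelow-- (suc n) f g =
  trans (cong (λ s → f 0 - g 0 + s) (sumBelow-- n (f ∘ suc) (g ∘ suc)))
        (interchange (f 0) (g 0) (sumBelow n (f ∘ suc)) (sumBelow n (g ∘ suc)))
  where
  interchange : ∀ a b x y → a - b + (x - y) ≡ a + x - (b + y)
  interchange = solve-∀

sumBelow-last : ∀ n (f : ℕ → ℤ) → sumBelow (suc n) f ≡ sumBelow n f + f n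
sumBelow-last zero    f = trans (ℤP.+-identityʳ (f 0)) (sym (ℤP.+-identityˡ (f 0)))
sumBelow-last (suc n) f =
  trans (cong (λ s → f 0 + s) (sumBelow-last n (f ∘ suc))) (sym (ℤP.+-assoc (f 0) _ (f (suc n))))

coeff : ℕ → ℕ → ℤ
coeff n k = sgn (n ∸ k) * + (n C k)

coeff-zero : ∀ n → coeff (suc n) 0 ≡ - coeff n 0
coeff-zero n = sym (ℤP.neg-distribˡ-* (sgn n) (+ 1))

coeff-vanish : ∀ n → coeff n (suc n) ≡ + 0
coeff-vanish n = trans (cong (λ x → sgn (n ∸ suc n) * + x) (k>n⇒nCk≡0 (ℕP.n<1+n n)))
                       (ℤP.*-zeroʳ (sgn (n ∸ suc n)))

∸-unfold : ∀ {n k} → k < n → n ∸ k ≡ suc (n ∸ suc k)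
∸-unfold {suc n} (s≤s k≤n) = ℕP.+-∸-assoc 1 k≤n

-- The sign of C(n,k+1) is reversed when computed with exponent n-k; when k ≥ n
-- both sides vanish.
sign-flip : ∀ n k → sgn (n ∸ k) * + (n C suc k) ≡ - coeff n (suc k)
sign-flip n k with k <? n
... | yes k<n = trans (cong (λ j → sgn j * + (n C suc k)) (∸-unfold k<n))
                      (sym (ℤP.neg-distribˡ-* (sgn (n ∸ suc k)) (+ (n C suc k))))
... | no  k≮n rewrite k>n⇒nCk≡0 (s≤s (ℕP.≮⇒≥ k≮n))
                    | ℤP.*-zeroʳ (sgn (n ∸ k)) | ℤP.*-zeroʳ (sgn (n ∸ suc k)) = refl

coeff-pascal : ∀ n k → coeff (suc n) (suc k) ≡ coeff n k - coeff n (suc k)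
coeff-pascal n k = begin
  sgn (n ∸ k) * + (suc n C suc k)
    ≡⟨ cong (λ x → sgn (n ∸ k) * + x) (nCk+nC[k+1]≡[n+1]C[k+1] n k) ⟨
  sgn (n ∸ k) * + (n C k ℕ.+ n C suc k)
    ≡⟨ cong (sgn (n ∸ k) *_) (ℤP.pos-+ (n C k) (n C suc k)) ⟩
  sgn (n ∸ k) * (+ (n C k) + + (n C suc k))
    ≡⟨ ℤP.*-distribˡ-+ (sgn (n ∸ k)) (+ (n C k)) (+ (n C suc k)) ⟩
  coeff n k + sgn (n ∸ k) * + (n C suc k)
    ≡⟨ cong (λ s → coeff n k + s) (sign-flip n k) ⟩
  coeff n k - coeff n (suc k) ∎

finiteDiff : ℕ → (ℕ → ℤ) → ℤ
finiteDiff n b = sumBelow (suc n) (λ k → coeff n k * b k)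

altSum≡finiteDiff : ∀ n → altSum n ≡ finiteDiff n (λ k → + m k)
altSum≡finiteDiff n = foldr-applyUpTo (suc n) id (λ k → coeff n k * + m k)

finiteDiff-cong : ∀ n {b c : ℕ → ℤ} → (∀ k → b k ≡ c k) → finiteDiff n b ≡ finiteDiff n c
finiteDiff-cong n eq = sumBelow-cong (suc n) (λ k → cong (coeff n k *_) (eq k))

finiteDiff-zero : ∀ n → finiteDiff n (λ _ → + 0) ≡ + 0
finiteDiff-zero n = trans (sumBelow-cong (suc n) (ℤP.*-zeroʳ ∘ coeff n)) (sumBelow-zero (suc n))

finiteDiff-+ : ∀ n (b c : ℕ → ℤ) → finiteDiff n (λ k → b k + c k) ≡ finiteDiff n b + finiteDiff n c
finiteDiff-+ n b c =
  trans (sumBelow-cong (suc n) (λ k → ℤP.*-distribˡ-+ (coeff n k) (b k) (c k)))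
        (sumBelow-+ (suc n) (λ k → coeff n k * b k) (λ k → coeff n k * c k))

finiteDiff-- : ∀ n (b c : ℕ → ℤ) → finiteDiff n (λ k → b k - c k) ≡ finiteDiff n b - finiteDiff n c
finiteDiff-- n b c =
  trans (sumBelow-cong (suc n) (λ k → distrib (coeff n k) (b k) (c k)))
        (sumBelow-- (suc n) (λ k → coeff n k * b k) (λ k → coeff n k * c k))
  where
  distrib : ∀ a x y → a * (x - y) ≡ a * x - a * y
  distrib = solve-∀

-- Δ^(n+1) b = Δ^n (Δ b): a consequence of Pascal's rule.
finiteDiff-suc : ∀ n (b : ℕ → ℤ) → finiteDiff (suc n) b ≡ finiteDiff n (λ k → b (suc k) - b k)
finiteDiff-suc n b = begin
  coeff (suc n) 0 * b 0 + sumBelow (suc n) (λ k → coeff (suc n) (suc k) * b (suc k))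
    ≡⟨ cong₂ _+_ (cong (_* b 0) (coeff-zero n)) (sumBelow-cong (suc n) pascalTerm) ⟩
  (- coeff n 0) * b 0 + sumBelow (suc n) (λ k → coeff n k * b (suc k) - tailTerm k)
    ≡⟨ cong (λ s → (- coeff n 0) * b 0 + s) (sumBelow-- (suc n) (λ k → coeff n k * b (suc k)) tailTerm) ⟩
  (- coeff n 0) * b 0 + (finiteDiff n (b ∘ suc) - sumBelow (suc n) tailTerm)
    ≡⟨ cong (λ x → (- coeff n 0) * b 0 + (finiteDiff n (b ∘ suc) - x)) tail-drop ⟩
  (- coeff n 0) * b 0 + (finiteDiff n (b ∘ suc) - sumBelow n tailTerm)
    ≡⟨ regroup (coeff n 0) (b 0) (finiteDiff n (b ∘ suc)) (sumBelow n tailTerm) ⟩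
  finiteDiff n (b ∘ suc) - finiteDiff n b
    ≡⟨ finiteDiff-- n (b ∘ suc) b ⟨
  finiteDiff n (λ k → b (suc k) - b k) ∎
  where
  tailTerm : ℕ → ℤ
  tailTerm k = coeff n (suc k) * b (suc k)
  pascalTerm : ∀ k → coeff (suc n) (suc k) * b (suc k) ≡ coeff n k * b (suc k) - tailTerm k
  pascalTerm k = trans (cong (_* b (suc k)) (coeff-pascal n k)) (distrib (coeff n k) (coeff n (suc k)) (b (suc k)))
    where
    distrib : ∀ a c x → (a - c) * x ≡ a * x - c * x
    distrib = solve-∀
  tail-drop : sumBelow (suc n) tailTerm ≡ sumBelow n tailTerm
  tail-drop = begin
    sumBelow (suc n) tailTerm                             ≡⟨ sumBelow-last n tailTerm ⟩
    sumBelow n tailTerm + coeff n (suc n) * b (suc n)     ≡⟨ cong (λ x → sumBelow n tailTerm + x * b (suc n)) (coeff-vanish n) ⟩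
    sumBelow n tailTerm + + 0                             ≡⟨ ℤP.+-identityʳ _ ⟩
    sumBelow n tailTerm ∎
  regroup : ∀ c y x s → (- c) * y + (x - s) ≡ x - (c * y + s)
  regroup = solve-∀

dyck≡finiteDiff-motzkin : ∀ n ht →
  + meanders dyckSteps ht n ≡ finiteDiff n (λ k → + meanders motzkinSteps ht k)
dyck≡finiteDiff-motzkin zero    ht = refl
dyck≡finiteDiff-motzkin (suc n) ht = begin
  + meanders dyckSteps ht (suc n)
    ≡⟨ cong +_ (dyck-step ht n) ⟩
  + (meanders dyckSteps (suc ht) n ℕ.+ afterDown dyckSteps ht n)
    ≡⟨ ℤP.pos-+ (meanders dyckSteps (suc ht) n) (afterDown dyckSteps ht n) ⟩
  + meanders dyckSteps (suc ht) n + + afterDown dyckSteps ht n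
    ≡⟨ cong₂ _+_ (dyck≡finiteDiff-motzkin n (suc ht)) (afterDown-case ht) ⟩
  finiteDiff n up + finiteDiff n down
    ≡⟨ finiteDiff-+ n up down ⟨
  finiteDiff n (λ k → up k + down k)
    ≡⟨ finiteDiff-cong n motzkin-difference ⟩
  finiteDiff n (λ k → M (suc k) - M k)
    ≡⟨ finiteDiff-suc n M ⟨
  finiteDiff (suc n) M ∎
  where
  M up down : ℕ → ℤ
  M    k = + meanders motzkinSteps ht k
  up   k = + meanders motzkinSteps (suc ht) k
  down k = + afterDown motzkinSteps ht k
  afterDown-case : ∀ t → + afterDown dyckSteps t n ≡ finiteDiff n (λ k → + afterDown motzkinSteps t k)
  afterDown-case zero    = sym (finiteDiff-zero n)
  afterDown-case (suc t) = dyck≡finiteDiff-motzkin n t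
  motzkin-difference : ∀ k → up k + down k ≡ M (suc k) - M k
  motzkin-difference k = begin
    up k + down k                    ≡⟨ cancel (up k) (down k) (M k) ⟩
    up k + down k + M k - M k        ≡⟨ cong (λ x → x + M k - M k) (ℤP.pos-+ (meanders motzkinSteps (suc ht) k) _) ⟨
    + (meanders motzkinSteps (suc ht) k ℕ.+ afterDown motzkinSteps ht k) + M k - M k
      ≡⟨ cong (_- M k) (ℤP.pos-+ _ (meanders motzkinSteps ht k)) ⟨
    + (meanders motzkinSteps (suc ht) k ℕ.+ afterDown motzkinSteps ht k ℕ.+ meanders motzkinSteps ht k) - M k
      ≡⟨ cong (λ x → + x - M k) (motzkin-step ht k) ⟨
    M (suc k) - M k ∎
    where
    cancel : ∀ x y z → x + y ≡ x + y + z - z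
    cancel = solve-∀

theorem3p2 : (n : ℕ) → + d n ≡ altSum n
theorem3p2 n = begin
  + d n                                              ≡⟨ cong +_ (dyck-symmetric n) ⟩
  + meanders dyckSteps 0 n                           ≡⟨ dyck≡finiteDiff-motzkin n 0 ⟩
  finiteDiff n (λ k → + meanders motzkinSteps 0 k)   ≡⟨ finiteDiff-cong n (cong +_ ∘ sym ∘ motzkin-symmetric) ⟩
  finiteDiff n (λ k → + m k)                         ≡⟨ altSum≡finiteDiff n ⟨
  altSum n ∎
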